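{- Let $m\ge2$. A vector of multiplicities $[k_1,0,k_3,\dots,k_m]$ (nonnegative integers, second entry $0$) with $k_1>1$ is not allowable.
   Context: $(n_1,\dots,n_m)\times[k_1,\dots,k_m]$ denotes the partition with $k_i$ parts $n_i$ ($k_i\ge0$). The extended slow-Triangle map is $\tilde T=\tilde T_0$ if $n_2+n_m>n_1$ and $\tilde T=\tilde T_1$ if $n_2+n_m<n_1$ (undefined if equal), with $\tilde T_0((n_1,\dots,n_m)\times[k_1,\dots,k_m])=(n_2,\dots,n_m,n_1-n_2)\times[k_1+k_2,k_3,\dots,k_m,k_1]$ and $\tilde T_1((n_1,\dots,n_m)\times[k_1,\dots,k_m])=(n_1-n_m,n_2,\dots,n_m)\times[k_1,\dots,k_{m-1},k_1+k_m]$. A partition $\mu$ is a descendant of $\lambda$ if it is obtained from $\lambda$ by finitely many applications of $\tilde T$, each of them defined. A vector $[k_1,\dots,k_m]$ is allowable if there are integers $n_1>\cdots>n_m>0$ with $n_1\ne n_2+n_m$ and integers $a_1>\cdots>a_m>0$ such that $(a_1,\dots,a_m)\times[k_1,\dots,k_m]$ is a descendant of $(n_1,\dots,n_m)\times[1,0,\dots,0]$. -}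

module Defs where

open import Data.Nat using (ℕ; zero; suc; _+_; _∸_; _<_; _>_)
open import Data.Fin using (Fin)
import Data.Fin as F
open import Data.Vec using (Vec; _∷_; []; _∷ʳ_; last; init; lookup; replicate)
open import Data.Product using (Σ; _×_; _,_; ∃)
open import Relation.Binary.PropositionalEquality using (_≢_)
open import Relation.Binary.Construct.Closure.ReflexiveTransitive using (Star)

-- A partition (n₁,…,n_m)×[k₁,…,k_m] with m = suc (suc m') ≥ 2 parts-values,
-- stored as a pair (vector of part sizes, vector of multiplicities).
Part : ℕ → Set
Part m = Vec ℕ (suc (suc m)) × Vec ℕ (suc (suc m))

T₀ : ∀ {m} → Part m → Part m
T₀ (n₁ ∷ n₂ ∷ ns , k₁ ∷ k₂ ∷ ks) = (n₂ ∷ (ns ∷ʳ (n₁ ∸ n₂))) , ((k₁ + k₂) ∷ (ks ∷ʳ k₁))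

T₁ : ∀ {m} → Part m → Part m
T₁ (n₁ ∷ ns , k₁ ∷ ks) = ((n₁ ∸ last ns) ∷ ns) , (k₁ ∷ (init ks ∷ʳ (k₁ + last ks)))

n₁of n₂of nₘof : ∀ {m} → Part m → ℕ
n₁of (n₁ ∷ _ ∷ _ , _) = n₁
n₂of (_ ∷ n₂ ∷ _ , _) = n₂
nₘof (n₁ ∷ ns , _) = last ns

data Step {m : ℕ} : Part m → Part m → Set where
  step₀ : ∀ p → n₂of p + nₘof p > n₁of p → Step p (T₀ p)
  step₁ : ∀ p → n₂of p + nₘof p < n₁of p → Step p (T₁ p)

Descendant : ∀ {m} → Part m → Part m → Set
Descendant λ' μ = Star Step λ' μ

DecPos : ∀ {n} → Vec ℕ n → Set
DecPos {n} v = (∀ (i j : Fin n) → i F.< j → lookup v j < lookup v i)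
             × (∀ (i : Fin n) → 0 < lookup v i)

Allowable : ∀ {m} → Vec ℕ (suc (suc m)) → Set
Allowable {m} k =
  Σ (Vec ℕ (suc (suc m))) λ n → Σ (Vec ℕ (suc (suc m))) λ a →
    DecPos n × n₁of (n , k) ≢ n₂of (n , k) + nₘof (n , k) × DecPos a ×
    Descendant (n , 1 ∷ replicate (suc m) 0) (a , k)

-- Every descendant of (n₁,…,n_m)×[1,0,…,0] has multiplicity vector either
-- [1,0,…,0,k_j,…,k_m] with k_j,…,k_m > 0, or positive throughout: T̃₀ puts
-- k₁+k₂ in front and appends k₁, T̃₁ overwrites k_m by k₁+k_m, and neither can
-- create a zero or a leading entry other than 1 unless all entries are positive.
-- The vector [k₁,0,k₃,…,k_m] with k₁ > 1 has neither shape.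
module Submission where

open import Defs
open import Data.Nat using (ℕ; _<_; suc; _+_; s≤s; z≤n)
open import Data.Nat.Properties using (<-≤-trans; m≤m+n; <-irrefl)
open import Data.Vec using (Vec; _∷_; []; _∷ʳ_; init; last; replicate)
open import Data.Vec.Relation.Unary.All using (All; _∷_; [])
open import Data.Product using (_,_; proj₂)
open import Relation.Nullary using (¬_)
open import Relation.Binary.PropositionalEquality using (refl)
open import Relation.Binary.Construct.Closure.ReflexiveTransitive using (ε; _◅_)

Positive : ∀ {n} → Vec ℕ n → Set
Positive = All (0 <_)

Positive-∷ʳ : ∀ {n y} (xs : Vec ℕ n) → Positive xs → 0 < y → Positive (xs ∷ʳ y)
Positive-∷ʳ []       []         y>0 = y>0 ∷ []
Positive-∷ʳ (x ∷ xs) (x>0 ∷ ps) y>0 = x>0 ∷ Positive-∷ʳ xs ps y>0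

Positive-init : ∀ {n} (xs : Vec ℕ (suc n)) → Positive xs → Positive (init xs)
Positive-init (x ∷ [])      _          = []
Positive-init (x ∷ x′ ∷ xs) (x>0 ∷ ps) = x>0 ∷ Positive-init (x′ ∷ xs) ps

data ZerosThenPositive : ∀ {n} → Vec ℕ n → Set where
  positive : ∀ {n} {xs : Vec ℕ n} → Positive xs → ZerosThenPositive xs
  0∷_      : ∀ {n} {xs : Vec ℕ n} → ZerosThenPositive xs → ZerosThenPositive (0 ∷ xs)

zerosThenPositive-replicate : ∀ n → ZerosThenPositive (replicate n 0)
zerosThenPositive-replicate 0       = positive []
zerosThenPositive-replicate (suc n) = 0∷ zerosThenPositive-replicate n

zerosThenPositive-∷ʳ : ∀ {n y} {xs : Vec ℕ n} →
                       ZerosThenPositive xs → 0 < y → ZerosThenPositive (xs ∷ʳ y)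
zerosThenPositive-∷ʳ {xs = xs} (positive ps) y>0 = positive (Positive-∷ʳ xs ps y>0)
zerosThenPositive-∷ʳ (0∷ zs)                 y>0 = 0∷ zerosThenPositive-∷ʳ zs y>0

zerosThenPositive-init : ∀ {n} {xs : Vec ℕ (suc n)} →
                         ZerosThenPositive xs → ZerosThenPositive (init xs)
zerosThenPositive-init {xs = xs}        (positive ps) = positive (Positive-init xs ps)
zerosThenPositive-init {xs = 0 ∷ []}    (0∷ _)        = positive []
zerosThenPositive-init {xs = 0 ∷ _ ∷ _} (0∷ zs)       = 0∷ zerosThenPositive-init zs

data DescendantMultiplicities : ∀ {n} → Vec ℕ (suc n) → Set where
  leading-one : ∀ {n} {ks : Vec ℕ n} → ZerosThenPositive ks → DescendantMultiplicities (1 ∷ ks)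
  positive    : ∀ {n} {ks : Vec ℕ (suc n)} → Positive ks → DescendantMultiplicities ks

+-positiveˡ : ∀ {a} b → 0 < a → 0 < a + b
+-positiveˡ b a>0 = <-≤-trans a>0 (m≤m+n _ b)

descendantMultiplicities-T₀ : ∀ {m} (p : Part m) →
  DescendantMultiplicities (proj₂ p) → DescendantMultiplicities (proj₂ (T₀ p))
descendantMultiplicities-T₀ (_ ∷ _ ∷ _ , .1 ∷ .0 ∷ ks) (leading-one (0∷ zs)) =
  leading-one (zerosThenPositive-∷ʳ zs (s≤s z≤n))
descendantMultiplicities-T₀ (_ ∷ _ ∷ _ , .1 ∷ k₂ ∷ ks) (leading-one (positive (_ ∷ ps))) =
  positive (s≤s z≤n ∷ Positive-∷ʳ ks ps (s≤s z≤n))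
descendantMultiplicities-T₀ (_ ∷ _ ∷ _ , k₁ ∷ k₂ ∷ ks) (positive (k₁>0 ∷ _ ∷ ps)) =
  positive (+-positiveˡ k₂ k₁>0 ∷ Positive-∷ʳ ks ps k₁>0)

descendantMultiplicities-T₁ : ∀ {m} (p : Part m) →
  DescendantMultiplicities (proj₂ p) → DescendantMultiplicities (proj₂ (T₁ p))
descendantMultiplicities-T₁ (_ ∷ _ , .1 ∷ ks) (leading-one zs) =
  leading-one (zerosThenPositive-∷ʳ (zerosThenPositive-init zs) (s≤s z≤n))
descendantMultiplicities-T₁ (_ ∷ _ , k₁ ∷ ks) (positive (k₁>0 ∷ ps)) =
  positive (k₁>0 ∷ Positive-∷ʳ (init ks) (Positive-init ks ps) (+-positiveˡ (last ks) k₁>0))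

descendantMultiplicities-Descendant : ∀ {m} {p q : Part m} → Descendant p q →
  DescendantMultiplicities (proj₂ p) → DescendantMultiplicities (proj₂ q)
descendantMultiplicities-Descendant ε                  dm = dm
descendantMultiplicities-Descendant (step₀ p _ ◅ rest) dm =
  descendantMultiplicities-Descendant rest (descendantMultiplicities-T₀ p dm)
descendantMultiplicities-Descendant (step₁ p _ ◅ rest) dm =
  descendantMultiplicities-Descendant rest (descendantMultiplicities-T₁ p dm)

lemma5p10 : (m : ℕ) (k₁ : ℕ) (ks : Vec ℕ m) → 1 < k₁ → ¬ Allowable {m} (k₁ ∷ 0 ∷ ks)
lemma5p10 m k₁ ks k₁>1 (_ , _ , _ , _ , _ , d)
  with descendantMultiplicities-Descendant d
         (leading-one (zerosThenPositive-replicate (suc m)))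
... | leading-one _          = <-irrefl refl k₁>1
... | positive (_ ∷ () ∷ _)
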